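{- Let $m$ be an odd positive integer and let $c$ be a non-negative integer with $T(c)\equiv 0\pmod m$, where $T(k)=\frac{k^2+k}{2}$. Let $s$ be a non-negative integer with $T(s)<m$, and put $n=2cs+c+s$. Then $T(n)\equiv T(s)\pmod m$.
   Context: $T(k)=\frac{k^2+k}{2}$ denotes the $k$-th triangular number. The proposition asserts that all numbers with trivial and non-trivial triangular remainder modulo $m$ can be inferred from pairs $(c,c+1)$ with $T(c)\equiv 0\pmod m$ (zero, invariant tuples) in this way. -}

module Defs where

open import Data.Nat using (ℕ; _+_; _*_; _/_)

-- k-th triangular number T(k) = (k^2 + k)/2  (exact division; k^2+k is even)
T : ℕ → ℕ
T k = (k * k + k) / 2

module Submission where

open import Defs
open import Data.Nat using (ℕ; zero; suc; _+_; _*_; _<_; _%_; _/_; NonZero)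
open import Data.Nat.Divisibility using (_∣_)
open import Data.Nat.DivMod using (m≡m%n+[m/n]*n; [m+kn]%n≡m%n; m*n/n≡m)
open import Data.Nat.Properties using (*-distribˡ-+; *-comm; *-assoc; *-cancelˡ-≡)
open import Data.Nat.Solver using (module +-*-Solver)
open import Relation.Nullary using (¬_)
open import Relation.Binary.PropositionalEquality
open ≡-Reasoning
open +-*-Solver

-- With n = 2cs + c + s one has 2n + 1 = (2c + 1)(2s + 1), and since 8 T(k) + 1 = (2k + 1)²
-- this gives T(n) = 8 T(c) T(s) + T(c) + T(s).  Hence T(n) ≡ T(s) (mod m) as soon as
-- m ∣ T(c).

triangle : ℕ → ℕ
triangle zero    = 0
triangle (suc k) = suc k + triangle k

2*triangle≡k*k+k : ∀ k → 2 * triangle k ≡ k * k + k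
2*triangle≡k*k+k zero    = refl
2*triangle≡k*k+k (suc k) = begin
  2 * (suc k + triangle k)      ≡⟨ *-distribˡ-+ 2 (suc k) (triangle k) ⟩
  2 * suc k + 2 * triangle k    ≡⟨ cong (2 * suc k +_) (2*triangle≡k*k+k k) ⟩
  2 * suc k + (k * k + k)       ≡⟨ solve 1 (λ k → con 2 :* (con 1 :+ k) :+ (k :* k :+ k)
                                              := (con 1 :+ k) :* (con 1 :+ k) :+ (con 1 :+ k)) refl k ⟩
  suc k * suc k + suc k         ∎

T≡triangle : ∀ k → T k ≡ triangle k
T≡triangle k = begin
  (k * k + k) / 2       ≡⟨ cong (_/ 2) (sym (2*triangle≡k*k+k k)) ⟩
  (2 * triangle k) / 2  ≡⟨ cong (_/ 2) (*-comm 2 (triangle k)) ⟩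
  (triangle k * 2) / 2  ≡⟨ m*n/n≡m (triangle k) 2 ⟩
  triangle k            ∎

2*T≡k*k+k : ∀ k → 2 * T k ≡ k * k + k
2*T≡k*k+k k = trans (cong (2 *_) (T≡triangle k)) (2*triangle≡k*k+k k)

T[2cs+c+s]≡8TcTs+Tc+Ts : ∀ c s → T (2 * c * s + c + s) ≡ 8 * T c * T s + T c + T s
T[2cs+c+s]≡8TcTs+Tc+Ts c s = *-cancelˡ-≡ _ _ 2 (begin
  2 * T n                                       ≡⟨ 2*T≡k*k+k n ⟩
  n * n + n                                     ≡⟨ solve 2 (λ c s → let n = con 2 :* c :* s :+ c :+ s in
                                                     n :* n :+ n
                                                     := con 4 :* (c :* c :+ c) :* (s :* s :+ s)
                                                        :+ (c :* c :+ c) :+ (s :* s :+ s)) refl c s ⟩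
  4 * (c * c + c) * (s * s + s) + (c * c + c) + (s * s + s)
    ≡⟨ cong₂ (λ a b → 4 * a * b + a + b) (sym (2*T≡k*k+k c)) (sym (2*T≡k*k+k s)) ⟩
  4 * (2 * T c) * (2 * T s) + 2 * T c + 2 * T s ≡⟨ solve 2 (λ x y →
                                                     con 4 :* (con 2 :* x) :* (con 2 :* y) :+ con 2 :* x :+ con 2 :* y
                                                     := con 2 :* (con 8 :* x :* y :+ x :+ y)) refl (T c) (T s) ⟩
  2 * (8 * T c * T s + T c + T s)               ∎)
  where n = 2 * c * s + c + s

[m+kx]%n≡m%n : ∀ m k x n .{{_ : NonZero n}} → x % n ≡ 0 → (m + k * x) % n ≡ m % n
[m+kx]%n≡m%n m k x n x%n≡0 = begin
  (m + k * x) % n              ≡⟨ cong (λ z → (m + k * z) % n) x≡[x/n]*n ⟩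
  (m + k * ((x / n) * n)) % n  ≡⟨ cong (λ y → (m + y) % n) (sym (*-assoc k (x / n) n)) ⟩
  (m + k * (x / n) * n) % n    ≡⟨ [m+kn]%n≡m%n m (k * (x / n)) n ⟩
  m % n                        ∎
  where
  x≡[x/n]*n : x ≡ (x / n) * n
  x≡[x/n]*n = trans (m≡m%n+[m/n]*n x n) (cong (_+ (x / n) * n) x%n≡0)

proposition7 : (m : ℕ) → .{{_ : NonZero m}} → ¬ (2 ∣ m) →
    (c : ℕ) → T c % m ≡ 0 →
    (s : ℕ) → T s < m →
    T (2 * c * s + c + s) % m ≡ T s % m
proposition7 m _ c Tc%m≡0 s _ = begin
  T (2 * c * s + c + s) % m          ≡⟨ cong (_% m) (T[2cs+c+s]≡8TcTs+Tc+Ts c s) ⟩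
  (8 * T c * T s + T c + T s) % m    ≡⟨ cong (_% m) (solve 2 (λ x y → con 8 :* x :* y :+ x :+ y
                                                               := y :+ (con 8 :* y :+ con 1) :* x) refl (T c) (T s)) ⟩
  (T s + (8 * T s + 1) * T c) % m    ≡⟨ [m+kx]%n≡m%n (T s) (8 * T s + 1) (T c) m Tc%m≡0 ⟩
  T s % m                            ∎
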